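{- Let $\mathcal S\subseteq\mathbf{\Psi}$ be an on-target set of polymers with concentration exponents $\mu$, and consider the level construction with level-$i$ imbalance $k_i$ and novelty $l_i$. For every $i\ge1$ such that level $i+1$ is defined and every canonical reaction $\alpha$ with $l_{i+1}(\alpha)\neq0$, we have $k_i(\alpha)/l_i(\alpha)\le k_{i+1}(\alpha)/l_{i+1}(\alpha)$.
   Context: Multisets: a multiset $M$ over a finite set $A$ is a function $A\to\mathbb{N}$, $M[a]$ the count of $a$, $|M|=\sum_aM[a]$, sums pointwise, $M\cap S$ agrees with $M$ on $S$ and is $0$ elsewhere; $\mathbb{N}^S$ denotes multisets over $S$. Setting: $\mathbf{\Psi^0}$ a finite set of monomers; $\mathbf{\Psi}\subseteq\mathbb{N}^{\mathbf{\Psi^0}}$ a finite set of polymers. $M_1,M_2\in\mathbb{N}^{\mathbf{\Psi}}$ are reconfigurations, $M_1\cong M_2$, if for every monomer $m$, $\sum_PM_1[P]P[m]=\sum_PM_2[P]P[m]$; then $M_1\to M_2$ is a reaction. On-target set: $\mathcal S\subseteq\mathbf{\Psi}$ with $\mu:\mathcal S\to(0,1]$ such that (1) every $P\in\mathbf{\Psi}$ lies in some $M'$ with $M\cong M'$ for some $M\in\mathbb{N}^{\mathcal S}$; (2) $\mu(M_1)=\mu(M_2)$ whenever $M_1,M_2\in\mathbb{N}^{\mathcal S}$, $M_1\cong M_2$, where $\mu(M)=\sum_PM[P]\mu(P)$. A reaction $M_1\to M_2$ is canonical if $M_1\in\mathbb{N}^{\mathcal S}$. Level construction: $\mathcal S_0=\mathcal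 S$, $\bar\mu=\mu$ on $\mathcal S_0$. For $i\ge1$, with $L_{i-1}=\bigcup_{j<i}\mathcal S_j$ already assigned, for canonical $\alpha:M_1\to M_2$ let $\hat M_2=M_2\cap L_{i-1}$, $k_i(\alpha)=\bar\mu(M_1)-\bar\mu(\hat M_2)$, $l_i(\alpha)=|M_2|-|\hat M_2|$; $\mu_i=\min k_i(\alpha)/l_i(\alpha)$ over canonical $\alpha$ with $l_i(\alpha)\ne0$ (attained); reactions attaining it are $i$-levelizing; $\mathcal S_i$ is the set of polymers in products of $i$-levelizing reactions not in $L_{i-1}$, each assigned $\bar\mu(P)=\mu_i$. Repeat until all polymers are assigned.
   Formalization: The concentration exponents $\mu$ take values in the rationals of (0,1] rather than the reals, so the assigned values $\bar\mu$ and the minima $\mu_i$ are rational too. -}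

module Defs where

open import Data.Nat using (ℕ; zero; suc; _+_; _*_; _∸_; _<_)
open import Data.Integer using (+_)
open import Data.Fin using (Fin; zero; suc)
open import Data.Fin.Subset using (Subset; _∈_; _∉_; _∪_)
open import Data.Fin.Subset.Properties using (_∈?_)
open import Data.Rational as ℚ using (ℚ; _-_; _≤_; 0ℚ; 1ℚ) renaming (_/_ to _/ℚ_; _+_ to _+ℚ_; _*_ to _*ℚ_; _<_ to _<ℚ_)
open import Data.Product using (Σ; ∃; ∃-syntax; _×_)
open import Relation.Nullary using (¬_; does)
open import Relation.Binary.PropositionalEquality using (_≡_; _≢_)
open import Data.Bool using (if_then_else_)
open import Function using (_∘_; _⇔_)

Multiset : ℕ → Set
Multiset n = Fin n → ℕ

sumℕ : ∀ {n} → (Fin n → ℕ) → ℕ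
sumℕ {zero}  f = 0
sumℕ {suc n} f = f zero + sumℕ (f ∘ suc)

sumℚ : ∀ {n} → (Fin n → ℚ) → ℚ
sumℚ {zero}  f = 0ℚ
sumℚ {suc n} f = f zero +ℚ sumℚ (f ∘ suc)

toℚ : ℕ → ℚ
toℚ n = (+ n) /ℚ 1

size : ∀ {n} → Multiset n → ℕ
size M = sumℕ M

restrict : ∀ {n} → Multiset n → Subset n → Multiset n
restrict M S P = if does (P ∈? S) then M P else 0

SupportedOn : ∀ {n} → Subset n → Multiset n → Set
SupportedOn S M = ∀ P → P ∉ S → M P ≡ 0

-- Setting: monomers Fin m, polymers Fin p, with poly P the monomer multiset of P.
-- total count of monomer a in a multiset of polymers
monomerCount : ∀ {m p} → (Fin p → Multiset m) → Multiset p → Fin m → ℕ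
monomerCount poly M a = sumℕ (λ P → M P * poly P a)

Reconf : ∀ {m p} → (Fin p → Multiset m) → Multiset p → Multiset p → Set
Reconf poly M₁ M₂ = ∀ a → monomerCount poly M₁ a ≡ monomerCount poly M₂ a

weight : ∀ {p} → (Fin p → ℚ) → Multiset p → ℚ
weight w M = sumℚ (λ P → toℚ (M P) *ℚ w P)

-- 𝓢 ⊆ Ψ is on-target with concentration exponents μ (μ only matters on 𝓢)
OnTarget : ∀ {m p} → (Fin p → Multiset m) → Subset p → (Fin p → ℚ) → Set
OnTarget poly S μ =
  (∀ P → P ∈ S → (0ℚ <ℚ μ P) × (μ P ≤ 1ℚ))
  × (∀ P → ∃[ M ] ∃[ M' ] (SupportedOn S M × Reconf poly M M' × 0 < M' P))
  × (∀ M₁ M₂ → SupportedOn S M₁ → SupportedOn S M₂ → Reconf poly M₁ M₂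
       → weight μ M₁ ≡ weight μ M₂)

Canonical : ∀ {m p} → (Fin p → Multiset m) → Subset p → Multiset p → Multiset p → Set
Canonical poly S M₁ M₂ = SupportedOn S M₁ × Reconf poly M₁ M₂

Lcum : ∀ {p} → (ℕ → Subset p) → ℕ → Subset p
Lcum Lv zero    = Lv zero
Lcum Lv (suc j) = Lcum Lv j ∪ Lv (suc j)

-- level-i imbalance k_i and novelty l_i (meaningful for i ≥ 1; junk value 0 at i = 0)
imbalance : ∀ {p} → (Fin p → ℚ) → (ℕ → Subset p) → ℕ → Multiset p → Multiset p → ℚ
imbalance μ̄ Lv zero    M₁ M₂ = 0ℚ
imbalance μ̄ Lv (suc j) M₁ M₂ = weight μ̄ M₁ - weight μ̄ (restrict M₂ (Lcum Lv j))

novelty : ∀ {p} → (ℕ → Subset p) → ℕ → Multiset p → ℕ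
novelty Lv zero    M₂ = 0
novelty Lv (suc j) M₂ = size M₂ ∸ size (restrict M₂ (Lcum Lv j))

-- k / l (total; division by l = 0 returns 0, never used where l ≠ 0 is not known)
divℚ : ℚ → ℕ → ℚ
divℚ k zero    = 0ℚ
divℚ k (suc n) = k *ℚ ((+ 1) /ℚ suc n)

ratio : ∀ {p} → (Fin p → ℚ) → (ℕ → Subset p) → ℕ → Multiset p → Multiset p → ℚ
ratio μ̄ Lv i M₁ M₂ = divℚ (imbalance μ̄ Lv i M₁ M₂) (novelty Lv i M₂)

Levelizing : ∀ {m p} → (Fin p → Multiset m) → Subset p → (ℕ → Subset p) → (Fin p → ℚ)
             → (ℕ → ℚ) → ℕ → Multiset p → Multiset p → Set
Levelizing poly S Lv μ̄ μs i M₁ M₂ =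
  Canonical poly S M₁ M₂ × novelty Lv i M₂ ≢ 0 × ratio μ̄ Lv i M₁ M₂ ≡ μs i

LevelStep : ∀ {m p} → (Fin p → Multiset m) → Subset p → (ℕ → Subset p) → (Fin p → ℚ)
            → (ℕ → ℚ) → ℕ → Set
LevelStep poly S Lv μ̄ μs j =
  (∀ M₁ M₂ → Canonical poly S M₁ M₂ → novelty Lv i M₂ ≢ 0 → μs i ≤ ratio μ̄ Lv i M₁ M₂)
  × (∃[ M₁ ] ∃[ M₂ ] Levelizing poly S Lv μ̄ μs i M₁ M₂)
  × (∀ P → (P ∈ Lv i) ⇔ (P ∉ Lcum Lv j
                         × ∃[ M₁ ] ∃[ M₂ ] (Levelizing poly S Lv μ̄ μs i M₁ M₂ × 0 < M₂ P)))
  × (∀ P → P ∈ Lv i → μ̄ P ≡ μs i)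
  where i = suc j

IsLevelConstruction : ∀ {m p} → (Fin p → Multiset m) → Subset p → (Fin p → ℚ)
                      → (ℕ → Subset p) → (Fin p → ℚ) → (ℕ → ℚ) → ℕ → Set
IsLevelConstruction poly S μ Lv μ̄ μs n =
  (Lv zero ≡ S)
  × (∀ P → P ∈ S → μ̄ P ≡ μ P)
  × (∀ j → suc j Data.Nat.≤ n → LevelStep poly S Lv μ̄ μs j)

{-# OPTIONS --safe #-}
-- Going from level i to level i + 1, the only products of α that change status are the E
-- copies of polymers of 𝓢ᵢ in M₂: they leave the novelty and enter the subtracted weight, each
-- with exponent μᵢ.  So kᵢ₊₁ = kᵢ − E μᵢ and lᵢ₊₁ = lᵢ − E, and as μᵢ ≤ kᵢ/lᵢ by minimality of
-- μᵢ, removing E items of value at most the mean kᵢ/lᵢ cannot lower the mean.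
module Submission where

open import Defs
open import Data.Nat using (ℕ; suc; _≤_)
open import Data.Fin using (Fin)
open import Data.Fin.Subset using (Subset)
open import Data.Rational using (ℚ) renaming (_≤_ to _≤ℚ_)
open import Relation.Binary.PropositionalEquality using (_≡_; _≢_)

open import Data.Nat as ℕ using (zero; _+_; _∸_; _<_; s≤s; z≤n)
import Data.Nat.Properties as ℕ
open import Data.Integer as ℤ using (+_)
import Data.Integer.Properties as ℤ
open import Data.Rational using (1ℚ; _-_; toℚᵘ) renaming (_+_ to _+ℚ_; _*_ to _*ℚ_; _/_ to _/ℚ_)
open import Data.Rational.Properties
open import Data.Rational.Unnormalised.Base as ℚᵘ using (mkℚᵘ; *≡*) renaming (_≃_ to _≃ᵘ_)
import Data.Rational.Unnormalised.Properties as ℚᵘ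
open import Data.Rational.Solver using (module +-*-Solver)
open import Data.Fin using (zero; suc)
open import Data.Fin.Subset using (_∈_; _∉_; _∪_)
open import Data.Fin.Subset.Properties using (_∈?_; x∈p∪q⁺; x∈p∪q⁻)
open import Data.Product using (_,_; proj₁; proj₂)
open import Data.Sum using (inj₁; inj₂; [_,_]′)
open import Function using (_∘_)
open import Relation.Nullary using (yes; no; contradiction)
open import Relation.Binary.PropositionalEquality
  using (refl; sym; trans; cong; cong₂; subst; _≗_; module ≡-Reasoning)
open import Algebra.Bundles using (CommutativeMonoid)
import Algebra.Properties.CommutativeSemigroup as CommutativeSemigroupProperties
open import Function.Bundles using (Equivalence)

private
  module ℕ+ = CommutativeSemigroupProperties ℕ.+-commutativeSemigroup
  module ℚ+ = CommutativeSemigroupProperties (CommutativeMonoid.commutativeSemigroup +-0-commutativeMonoid)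

-- toℚ n = + n / 1 is definitionally fromℚᵘ (mkℚᵘ (+ n) 0), so facts about toℚ are checked in ℚᵘ.
toℚᵘ-toℚ : ∀ n → toℚᵘ (toℚ n) ≃ᵘ mkℚᵘ (+ n) 0
toℚᵘ-toℚ n = toℚᵘ-fromℚᵘ (mkℚᵘ (+ n) 0)

toℚ-+ : ∀ m n → toℚ (m + n) ≡ toℚ m +ℚ toℚ n
toℚ-+ m n = toℚᵘ-injective (begin
  toℚᵘ (toℚ (m + n))              ≈⟨ toℚᵘ-toℚ (m + n) ⟩
  mkℚᵘ (+ (m + n)) 0              ≈⟨ *≡* numerators ⟩
  mkℚᵘ (+ m) 0 ℚᵘ.+ mkℚᵘ (+ n) 0  ≈⟨ ℚᵘ.+-cong (toℚᵘ-toℚ m) (toℚᵘ-toℚ n) ⟨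
  toℚᵘ (toℚ m) ℚᵘ.+ toℚᵘ (toℚ n)  ≈⟨ toℚᵘ-homo-+ (toℚ m) (toℚ n) ⟨
  toℚᵘ (toℚ m +ℚ toℚ n)           ∎)
  where
  open ℚᵘ.≃-Reasoning
  numerators : + (m + n) ℤ.* + 1 ≡ (+ m ℤ.* + 1 ℤ.+ + n ℤ.* + 1) ℤ.* + 1
  numerators = trans (ℤ.*-identityʳ _) (trans (ℤ.pos-+ m n) (sym (trans (ℤ.*-identityʳ _)
    (cong₂ ℤ._+_ (ℤ.*-identityʳ (+ m)) (ℤ.*-identityʳ (+ n))))))

1/suc-inverseˡ : ∀ n → ((+ 1) /ℚ suc n) *ℚ toℚ (suc n) ≡ 1ℚ
1/suc-inverseˡ n = toℚᵘ-injective (begin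
  toℚᵘ ((+ 1) /ℚ suc n *ℚ toℚ (suc n))  ≈⟨ toℚᵘ-homo-* ((+ 1) /ℚ suc n) (toℚ (suc n)) ⟩
  toℚᵘ ((+ 1) /ℚ suc n) ℚᵘ.* toℚᵘ (toℚ (suc n))
    ≈⟨ ℚᵘ.*-cong (toℚᵘ-fromℚᵘ (mkℚᵘ (+ 1) n)) (toℚᵘ-toℚ (suc n)) ⟩
  mkℚᵘ (+ 1) n ℚᵘ.* mkℚᵘ (+ suc n) 0                   ≈⟨ *≡* (cong (λ d → + suc d) denominators) ⟩
  ℚᵘ.1ℚᵘ                                              ∎)
  where
  open ℚᵘ.≃-Reasoning
  denominators : (n + 0) ℕ.* 1 ≡ n ℕ.* 1 + 0
  denominators = trans (ℕ.*-identityʳ _) (trans (ℕ.+-identityʳ n) (sym (trans (ℕ.+-identityʳ _) (ℕ.*-identityʳ n))))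

divℚ-*-toℚ : ∀ k {l} → l ≢ 0 → divℚ k l *ℚ toℚ l ≡ k
divℚ-*-toℚ k {zero}  l≢0 = contradiction refl l≢0
divℚ-*-toℚ k {suc n} _   = begin
  k *ℚ (+ 1 /ℚ suc n) *ℚ toℚ (suc n)   ≡⟨ *-assoc k _ (toℚ (suc n)) ⟩
  k *ℚ ((+ 1 /ℚ suc n) *ℚ toℚ (suc n)) ≡⟨ cong (k *ℚ_) (1/suc-inverseˡ n) ⟩
  k *ℚ 1ℚ                              ≡⟨ *-identityʳ k ⟩
  k                                    ∎
  where open ≡-Reasoning

*-toℚ≤⇒≤divℚ : ∀ {q k} l → l ≢ 0 → q *ℚ toℚ l ≤ℚ k → q ≤ℚ divℚ k l
*-toℚ≤⇒≤divℚ zero    l≢0 _ = contradiction refl l≢0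
*-toℚ≤⇒≤divℚ {q} {k} (suc n) _ ql≤k = begin
  q                                    ≡⟨ *-identityʳ q ⟨
  q *ℚ 1ℚ                              ≡⟨ cong (q *ℚ_) (trans (*-comm (toℚ (suc n)) _) (1/suc-inverseˡ n)) ⟨
  q *ℚ (toℚ (suc n) *ℚ (+ 1 /ℚ suc n)) ≡⟨ *-assoc q (toℚ (suc n)) _ ⟨
  q *ℚ toℚ (suc n) *ℚ (+ 1 /ℚ suc n)   ≤⟨ *-monoʳ-≤-nonNeg (+ 1 /ℚ suc n) ql≤k ⟩
  k *ℚ (+ 1 /ℚ suc n)                  ∎
  where
  open ≤-Reasoning
  instance _ = normalize-nonNeg 1 (suc n)

divℚ-≤-remove-below : ∀ k c l e → l ∸ e ≢ 0 → c ≤ℚ divℚ k l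
                      → divℚ k l ≤ℚ divℚ (k - toℚ e *ℚ c) (l ∸ e)
divℚ-≤-remove-below k c l e l∸e≢0 c≤r = *-toℚ≤⇒≤divℚ (l ∸ e) l∸e≢0 (begin
  r *ℚ toℚ (l ∸ e)                              ≡⟨ r*a≡r*[a+e]-e*r r (toℚ (l ∸ e)) (toℚ e) ⟩
  r *ℚ (toℚ (l ∸ e) +ℚ toℚ e) - toℚ e *ℚ r      ≡⟨ cong (λ x → r *ℚ x - toℚ e *ℚ r) (toℚ-+ (l ∸ e) e) ⟨
  r *ℚ toℚ (l ∸ e + e) - toℚ e *ℚ r             ≡⟨ cong (λ x → r *ℚ toℚ x - toℚ e *ℚ r) (ℕ.m∸n+n≡m e≤l) ⟩
  r *ℚ toℚ l - toℚ e *ℚ r                       ≡⟨ cong (_- toℚ e *ℚ r) (divℚ-*-toℚ k l≢0) ⟩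
  k - toℚ e *ℚ r                                ≤⟨ +-monoʳ-≤ k (neg-antimono-≤ (*-monoˡ-≤-nonNeg (toℚ e) c≤r)) ⟩
  k - toℚ e *ℚ c                                ∎)
  where
  open ≤-Reasoning
  instance _ = normalize-nonNeg e 1
  r = divℚ k l
  e<l : e < l
  e<l = ℕ.m∸n≢0⇒n<m {l} {e} l∸e≢0
  e≤l : e ≤ l
  e≤l = ℕ.<⇒≤ e<l
  l≢0 : l ≢ 0
  l≢0 = ℕ.m<n⇒n≢0 e<l
  r*a≡r*[a+e]-e*r : ∀ r a e → r *ℚ a ≡ r *ℚ (a +ℚ e) - e *ℚ r
  r*a≡r*[a+e]-e*r = solve 3 (λ r a e → r :* a := r :* (a :+ e) :- e :* r) refl
    where open +-*-Solver

sumℕ-cong : ∀ {n} {f g : Fin n → ℕ} → f ≗ g → sumℕ f ≡ sumℕ g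
sumℕ-cong {zero}  f≗g = refl
sumℕ-cong {suc n} f≗g = cong₂ _+_ (f≗g zero) (sumℕ-cong (f≗g ∘ suc))

sumℚ-cong : ∀ {n} {f g : Fin n → ℚ} → f ≗ g → sumℚ f ≡ sumℚ g
sumℚ-cong {zero}  f≗g = refl
sumℚ-cong {suc n} f≗g = cong₂ _+ℚ_ (f≗g zero) (sumℚ-cong (f≗g ∘ suc))

sumℕ-+ : ∀ {n} (f g : Fin n → ℕ) → sumℕ (λ P → f P + g P) ≡ sumℕ f + sumℕ g
sumℕ-+ {zero}  f g = refl
sumℕ-+ {suc n} f g = trans (cong (_+_ (f zero + g zero)) (sumℕ-+ (f ∘ suc) (g ∘ suc)))
                           (ℕ+.interchange (f zero) (g zero) (sumℕ (f ∘ suc)) (sumℕ (g ∘ suc)))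

sumℚ-+ : ∀ {n} (f g : Fin n → ℚ) → sumℚ (λ P → f P +ℚ g P) ≡ sumℚ f +ℚ sumℚ g
sumℚ-+ {zero}  f g = refl
sumℚ-+ {suc n} f g = trans (cong ((f zero +ℚ g zero) +ℚ_) (sumℚ-+ (f ∘ suc) (g ∘ suc)))
                           (ℚ+.interchange (f zero) (g zero) (sumℚ (f ∘ suc)) (sumℚ (g ∘ suc)))

sumℚ-toℚ-*ʳ : ∀ {n} (f : Fin n → ℕ) c → sumℚ (λ P → toℚ (f P) *ℚ c) ≡ toℚ (sumℕ f) *ℚ c
sumℚ-toℚ-*ʳ {zero}  f c = sym (*-zeroˡ c)
sumℚ-toℚ-*ʳ {suc n} f c = begin
  toℚ (f zero) *ℚ c +ℚ sumℚ (λ P → toℚ (f (suc P)) *ℚ c) ≡⟨ cong (toℚ (f zero) *ℚ c +ℚ_) (sumℚ-toℚ-*ʳ (f ∘ suc) c) ⟩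
  toℚ (f zero) *ℚ c +ℚ toℚ (sumℕ (f ∘ suc)) *ℚ c         ≡⟨ *-distribʳ-+ c (toℚ (f zero)) _ ⟨
  (toℚ (f zero) +ℚ toℚ (sumℕ (f ∘ suc))) *ℚ c            ≡⟨ cong (_*ℚ c) (toℚ-+ (f zero) _) ⟨
  toℚ (f zero + sumℕ (f ∘ suc)) *ℚ c                      ∎
  where open ≡-Reasoning

_+ₘ_ : ∀ {n} → Multiset n → Multiset n → Multiset n
(A +ₘ B) P = A P + B P

weight-+ₘ : ∀ {n} (w : Fin n → ℚ) (A B : Multiset n) → weight w (A +ₘ B) ≡ weight w A +ℚ weight w B
weight-+ₘ w A B = trans (sumℚ-cong distrib) (sumℚ-+ (λ P → toℚ (A P) *ℚ w P) (λ P → toℚ (B P) *ℚ w P))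
  where
  distrib : ∀ P → toℚ (A P + B P) *ℚ w P ≡ toℚ (A P) *ℚ w P +ℚ toℚ (B P) *ℚ w P
  distrib P = trans (cong (_*ℚ w P) (toℚ-+ (A P) (B P))) (*-distribʳ-+ (w P) (toℚ (A P)) (toℚ (B P)))

restrict-∈ : ∀ {n} (M : Multiset n) {S P} → P ∈ S → restrict M S P ≡ M P
restrict-∈ M {S} {P} P∈S with P ∈? S
... | yes _   = refl
... | no P∉S  = contradiction P∈S P∉S

restrict-∉ : ∀ {n} (M : Multiset n) {S P} → P ∉ S → restrict M S P ≡ 0
restrict-∉ M {S} {P} P∉S with P ∈? S
... | yes P∈S = contradiction P∈S P∉S
... | no _    = refl

restrict-∪ : ∀ {n} (M : Multiset n) {L V : Subset n} → (∀ P → P ∈ V → P ∉ L)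
             → restrict M (L ∪ V) ≗ restrict M L +ₘ restrict M V
restrict-∪ M {L} {V} disjoint P with P ∈? L | P ∈? V
... | yes P∈L | yes P∈V = contradiction P∈L (disjoint P P∈V)
... | yes P∈L | no _    = trans (restrict-∈ M (x∈p∪q⁺ (inj₁ P∈L))) (sym (ℕ.+-identityʳ (M P)))
... | no _    | yes P∈V = restrict-∈ M (x∈p∪q⁺ (inj₂ P∈V))
... | no P∉L  | no P∉V  = restrict-∉ M (λ P∈L∪V → [ P∉L , P∉V ]′ (x∈p∪q⁻ L V P∈L∪V))

weight-restrict-const : ∀ {n} (w : Fin n → ℚ) c (M : Multiset n) {V : Subset n}
                        → (∀ P → P ∈ V → w P ≡ c)
                        → weight w (restrict M V) ≡ toℚ (size (restrict M V)) *ℚ c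
weight-restrict-const w c M {V} w≡c = trans (sumℚ-cong pointwise) (sumℚ-toℚ-*ʳ (restrict M V) c)
  where
  pointwise : ∀ P → toℚ (restrict M V P) *ℚ w P ≡ toℚ (restrict M V P) *ℚ c
  pointwise P with P ∈? V
  ... | yes P∈V = cong (toℚ (M P) *ℚ_) (w≡c P P∈V)
  ... | no _    = trans (*-zeroˡ (w P)) (sym (*-zeroˡ c))

size-restrict-∪ : ∀ {n} (M : Multiset n) {L V : Subset n} → (∀ P → P ∈ V → P ∉ L)
                  → size (restrict M (L ∪ V)) ≡ size (restrict M L) + size (restrict M V)
size-restrict-∪ M {L} {V} disjoint =
  trans (sumℕ-cong (restrict-∪ M disjoint)) (sumℕ-+ (restrict M L) (restrict M V))

weight-restrict-∪ : ∀ {n} (w : Fin n → ℚ) c (M : Multiset n) {L V : Subset n}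
                    → (∀ P → P ∈ V → P ∉ L) → (∀ P → P ∈ V → w P ≡ c)
                    → weight w (restrict M (L ∪ V)) ≡ weight w (restrict M L) +ℚ toℚ (size (restrict M V)) *ℚ c
weight-restrict-∪ w c M {L} {V} disjoint w≡c = begin
  weight w (restrict M (L ∪ V))                          ≡⟨ sumℚ-cong (λ P → cong (λ k → toℚ k *ℚ w P) (restrict-∪ M disjoint P)) ⟩
  weight w (restrict M L +ₘ restrict M V)                ≡⟨ weight-+ₘ w (restrict M L) (restrict M V) ⟩
  weight w (restrict M L) +ℚ weight w (restrict M V)     ≡⟨ cong (weight w (restrict M L) +ℚ_) (weight-restrict-const w c M w≡c) ⟩
  weight w (restrict M L) +ℚ toℚ (size (restrict M V)) *ℚ c ∎
  where open ≡-Reasoning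

module _ {p} (Lv : ℕ → Subset p) (j : ℕ) (M₂ : Multiset p)
         (new : ∀ P → P ∈ Lv (suc j) → P ∉ Lcum Lv j) where

  private
    E : ℕ
    E = size (restrict M₂ (Lv (suc j)))

  novelty-suc : novelty Lv (suc (suc j)) M₂ ≡ novelty Lv (suc j) M₂ ∸ E
  novelty-suc = trans (cong (size M₂ ∸_) (size-restrict-∪ M₂ new))
                      (sym (ℕ.∸-+-assoc (size M₂) (size (restrict M₂ (Lcum Lv j))) E))

  imbalance-suc : ∀ (μ̄ : Fin p → ℚ) c M₁ → (∀ P → P ∈ Lv (suc j) → μ̄ P ≡ c)
                  → imbalance μ̄ Lv (suc (suc j)) M₁ M₂ ≡ imbalance μ̄ Lv (suc j) M₁ M₂ - toℚ E *ℚ c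
  imbalance-suc μ̄ c M₁ μ̄≡c = trans (cong (weight μ̄ M₁ -_) (weight-restrict-∪ μ̄ c M₂ new μ̄≡c))
                                   (x-[y+z]≡x-y-z (weight μ̄ M₁) (weight μ̄ (restrict M₂ (Lcum Lv j))) (toℚ E *ℚ c))
    where
    x-[y+z]≡x-y-z : ∀ x y z → x - (y +ℚ z) ≡ x - y - z
    x-[y+z]≡x-y-z = solve 3 (λ x y z → x :- (y :+ z) := x :- y :- z) refl
      where open +-*-Solver

lemma16 : ∀ {m p} (poly : Fin p → Multiset m)
          → (∀ P Q → (∀ a → poly P a ≡ poly Q a) → P ≡ Q)
          → (S : Subset p) (μ : Fin p → ℚ) → OnTarget poly S μ
          → (Lv : ℕ → Subset p) (μ̄ : Fin p → ℚ) (μs : ℕ → ℚ) (n : ℕ)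
          → IsLevelConstruction poly S μ Lv μ̄ μs n
          → ∀ i → 1 ≤ i → suc i ≤ n
          → ∀ M₁ M₂ → Canonical poly S M₁ M₂ → novelty Lv (suc i) M₂ ≢ 0
          → ratio μ̄ Lv i M₁ M₂ ≤ℚ ratio μ̄ Lv (suc i) M₁ M₂
lemma16 poly _ S μ _ Lv μ̄ μs n (_ , _ , levels) (suc j) (s≤s z≤n) 2+j≤n M₁ M₂ canonical l′≢0 = begin
  ratio μ̄ Lv (suc j) M₁ M₂                    ≤⟨ divℚ-≤-remove-below k c l E l∸E≢0 (lower-bound M₁ M₂ canonical l≢0) ⟩
  divℚ (k - toℚ E *ℚ c) (l ∸ E)               ≡⟨ cong₂ divℚ (imbalance-suc Lv j M₂ new μ̄ c M₁ μ̄≡c) (novelty-suc Lv j M₂ new) ⟨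
  ratio μ̄ Lv (suc (suc j)) M₁ M₂              ∎
  where
  open ≤-Reasoning
  c = μs (suc j)
  k = imbalance μ̄ Lv (suc j) M₁ M₂
  l = novelty Lv (suc j) M₂
  E = size (restrict M₂ (Lv (suc j)))
  step = levels j (ℕ.<⇒≤ 2+j≤n)
  lower-bound = proj₁ step
  new : ∀ P → P ∈ Lv (suc j) → P ∉ Lcum Lv j
  new P P∈Lv = proj₁ (Equivalence.to (proj₁ (proj₂ (proj₂ step)) P) P∈Lv)
  μ̄≡c = proj₂ (proj₂ (proj₂ step))
  l∸E≢0 : l ∸ E ≢ 0
  l∸E≢0 = subst (_≢ 0) (novelty-suc Lv j M₂ new) l′≢0
  l≢0 : l ≢ 0
  l≢0 = ℕ.m<n⇒n≢0 (ℕ.m∸n≢0⇒n<m {l} {E} l∸E≢0)
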